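{- Let $D=(V,A)$ be an acyclic digraph with $V\subset\mathbb{Z}^+$, $|V|=n\ge3$, and let $S\subseteq V$ be ideal in $D$. Then $\mathcal{R}(D)=\mathcal{R}(D-S)$ and $\mathcal{W}(D)=\mathcal{W}(D-S)$.
   Context: $R_D(y)$ is the set of vertices $v\ne y$ reachable from $y$ by a directed path; $F_D(y)=\{v:(y,v)\in A\}$. A set $S\subseteq V$ is ideal in $D$ if $S=\emptyset$ or: (i.1) $R_D(y)\subseteq S$ for each $y\in S$; (i.2) for each $y\in S$, $F_D(y)=\emptyset$ or $y<\min F_D(y)$; (i.3) either $S=V$ and $\min V\ge2$, or $\min S\ge 2+\max(V\setminus S)$. $D-S$ is the digraph obtained by deleting $S$. For an acyclic digraph $H$ with vertex set in $\mathbb{Z}^+$: $\mathcal{R}(H)$ is the set of arcs $(a,b)$ with $a>b$; $u\prec_H v$ means a directed path from $u$ to $v$ exists, $u\not\approx_H v$ means neither $u\prec_H v$ nor $v\prec_H u$; $\mathcal{W}(H)$ is the set of $3$-element vertex sets $\{a,b,c\}$ with $a<b<c$, $(c,a)$ an arc, $a\not\approx_H b$, $c\not\approx_H b$. -}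

module Defs where

open import Data.Nat using (ℕ; _<_; _≤_; _>_; _≟_)
open import Data.Nat.Properties using () renaming (_≟_ to _≟ℕ_)
open import Data.Product using (_×_; _,_; Σ; ∃)
open import Data.Sum using (_⊎_)
open import Data.List using (List; filter; length)
open import Data.List.Membership.Propositional using (_∈_; _∉_)
open import Data.List.Membership.DecPropositional _≟ℕ_ using (_∉?_)
open import Data.List.Relation.Unary.All using (All)
open import Data.List.Relation.Unary.Unique.Propositional using (Unique)
open import Relation.Nullary using (¬_)
open import Relation.Nullary.Decidable using (_×-dec_)
open import Relation.Binary.PropositionalEquality using (_≡_; _≢_)

record Digraph : Set where
  constructor mkDigraph
  field
    verts : List ℕ
    arcs  : List (ℕ × ℕ)
open Digraph public

-- Well-formedness: V ⊂ ℤ⁺ (positive naturals, no repetitions), arcs join vertices.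
record WellFormed (D : Digraph) : Set where
  field
    uniqueV  : Unique (verts D)
    positive : ∀ {v} → v ∈ verts D → 1 ≤ v
    arcsIn   : ∀ {u v} → (u , v) ∈ arcs D → (u ∈ verts D) × (v ∈ verts D)

Arc : Digraph → ℕ → ℕ → Set
Arc D u v = (u , v) ∈ arcs D

data Path (D : Digraph) : ℕ → ℕ → Set where
  edge : ∀ {u v} → Arc D u v → Path D u v
  step : ∀ {u v w} → Arc D u v → Path D v w → Path D u w

Acyclic : Digraph → Set
Acyclic D = ∀ u → ¬ Path D u u

Ideal : Digraph → List ℕ → Set
Ideal D S =
  (∀ {y} → y ∈ S → y ∈ verts D)
  × ( (∀ {y} → ¬ (y ∈ S))
    ⊎ ( (∀ {y v} → y ∈ S → Path D y v → v ≢ y → v ∈ S)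
      × (∀ {y v} → y ∈ S → Arc D y v → y < v)                      -- (i.2) F_D(y)=∅ or y < min F_D(y)
      × ( ((∀ {v} → v ∈ verts D → v ∈ S) × (∀ {v} → v ∈ verts D → 2 ≤ v))
        ⊎ ( (∃ λ y → y ∈ S) × (∃ λ v → v ∈ verts D × v ∉ S)
          × (∀ {y v} → y ∈ S → v ∈ verts D → v ∉ S → 2 + v ≤ y)))))
                                                                   -- (i.3b) min S ≥ 2 + max (V∖S)
  where open import Data.Nat using (_+_)

_-ᵛ_ : Digraph → List ℕ → Digraph
D -ᵛ S = mkDigraph (filter (_∉? S) (verts D))
                   (filter (λ e → (Data.Product.proj₁ e ∉? S) ×-dec (Data.Product.proj₂ e ∉? S)) (arcs D))

𝓡 : Digraph → ℕ → ℕ → Set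
𝓡 H a b = Arc H a b × b < a

_≺[_]_ : ℕ → Digraph → ℕ → Set
u ≺[ H ] v = Path H u v

_≉[_]_ : ℕ → Digraph → ℕ → Set
u ≉[ H ] v = ¬ (u ≺[ H ] v) × ¬ (v ≺[ H ] u)

𝓦 : Digraph → ℕ → ℕ → ℕ → Set
𝓦 H a b c =
  (a ∈ verts H) × (b ∈ verts H) × (c ∈ verts H)
  × a < b × b < c × Arc H c a × (a ≉[ H ] b) × (c ≉[ H ] b)

-- An ideal set S only has arcs leaving it upwards and lies entirely above V ∖ S, so a
-- descending arc (c , a) has both ends outside S; for a triple of 𝓦 the middle vertex b
-- also avoids S because b < c. Deleting S therefore keeps all these arcs and vertices, and
-- it does not change reachability between vertices outside S: a path leaving S can never
-- come back, since everything reachable from S lies in S.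
module Submission where

open import Defs
open import Data.Nat using (ℕ; _≤_; _<_)
open import Data.Nat.Properties using (<-asym; <-trans; <⇒≤) renaming (_≟_ to _≟ℕ_)
open import Data.List using (List; length)
open import Data.List.Membership.Propositional using (_∈_; _∉_)
open import Data.List.Membership.Propositional.Properties using (∈-filter⁺; ∈-filter⁻)
open import Data.List.Membership.DecPropositional _≟ℕ_ using (_∉?_; _∈?_)
open import Data.Product using (_×_; _,_; proj₁; proj₂)
open import Data.Sum using (inj₁; inj₂)
open import Data.Empty using (⊥-elim)
open import Function.Bundles using (_⇔_; mk⇔)
open import Relation.Nullary using (yes; no)
open import Relation.Nullary.Decidable using (_×-dec_)
open import Relation.Binary.PropositionalEquality using (_≡_; _≢_; refl)

ReachClosed : Digraph → List ℕ → Set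
ReachClosed D S = ∀ {y v} → y ∈ S → Path D y v → v ≢ y → v ∈ S

module Deletion (D : Digraph) (S : List ℕ) where

  delete-vert⁺ : ∀ {v} → v ∈ verts D → v ∉ S → v ∈ verts (D -ᵛ S)
  delete-vert⁺ = ∈-filter⁺ (_∉? S)

  delete-vert⁻ : ∀ {v} → v ∈ verts (D -ᵛ S) → v ∈ verts D × v ∉ S
  delete-vert⁻ = ∈-filter⁻ (_∉? S)

  delete-arc⁺ : ∀ {u v} → Arc D u v → u ∉ S → v ∉ S → Arc (D -ᵛ S) u v
  delete-arc⁺ uv u∉S v∉S = ∈-filter⁺ (λ e → (proj₁ e ∉? S) ×-dec (proj₂ e ∉? S)) uv (u∉S , v∉S)

  delete-arc⁻ : ∀ {u v} → Arc (D -ᵛ S) u v → Arc D u v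
  delete-arc⁻ uv = proj₁ (∈-filter⁻ (λ e → (proj₁ e ∉? S) ×-dec (proj₂ e ∉? S)) uv)

  delete-path⁻ : ∀ {u v} → Path (D -ᵛ S) u v → Path D u v
  delete-path⁻ (edge uv)   = edge (delete-arc⁻ uv)
  delete-path⁻ (step uw p) = step (delete-arc⁻ uw) (delete-path⁻ p)

  delete-path⁺ : ReachClosed D S → ∀ {u v} → Path D u v → u ∉ S → v ∉ S → Path (D -ᵛ S) u v
  delete-path⁺ closed (edge uv) u∉S v∉S = edge (delete-arc⁺ uv u∉S v∉S)
  delete-path⁺ closed (step {v = w} uw p) u∉S v∉S with w ∈? S
  ... | yes w∈S = ⊥-elim (v∉S (closed w∈S p λ { refl → v∉S w∈S }))
  ... | no  w∉S = step (delete-arc⁺ uw u∉S w∉S) (delete-path⁺ closed p w∉S v∉S)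

  delete-≉⁺ : ∀ {u v} → u ≉[ D ] v → u ≉[ D -ᵛ S ] v
  delete-≉⁺ (u⊀v , v⊀u) = (λ p → u⊀v (delete-path⁻ p)) , (λ p → v⊀u (delete-path⁻ p))

  delete-≉⁻ : ReachClosed D S → ∀ {u v} → u ∉ S → v ∉ S → u ≉[ D -ᵛ S ] v → u ≉[ D ] v
  delete-≉⁻ closed u∉S v∉S (u⊀v , v⊀u) =
    (λ p → u⊀v (delete-path⁺ closed p u∉S v∉S)) , (λ p → v⊀u (delete-path⁺ closed p v∉S u∉S))

record IdealProperties (D : Digraph) (S : List ℕ) : Set where
  field
    reach-closed  : ReachClosed D S
    arc-ascending : ∀ {y v} → y ∈ S → Arc D y v → y < v
    above-rest    : ∀ {y v} → y ∈ S → v ∈ verts D → v ∉ S → v < y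

Ideal⇒IdealProperties : ∀ {D S} → Ideal D S → IdealProperties D S
Ideal⇒IdealProperties (_ , inj₁ S-empty) = record
  { reach-closed  = λ y∈S → ⊥-elim (S-empty y∈S)
  ; arc-ascending = λ y∈S → ⊥-elim (S-empty y∈S)
  ; above-rest    = λ y∈S → ⊥-elim (S-empty y∈S)
  }
Ideal⇒IdealProperties (_ , inj₂ (closed , ascending , inj₁ (S-all , _))) = record
  { reach-closed  = closed
  ; arc-ascending = ascending
  ; above-rest    = λ _ v∈V v∉S → ⊥-elim (v∉S (S-all v∈V))
  }
Ideal⇒IdealProperties (_ , inj₂ (closed , ascending , inj₂ (_ , _ , gap))) = record
  { reach-closed  = closed
  ; arc-ascending = ascending
  ; above-rest    = λ y∈S v∈V v∉S → <⇒≤ (gap y∈S v∈V v∉S)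
  }

module _ {D : Digraph} {S : List ℕ} (wf : WellFormed D) (ideal : IdealProperties D S) where
  open WellFormed wf
  open IdealProperties ideal
  open Deletion D S

  descending-arc-∉ : ∀ {a b} → Arc D a b → b < a → a ∉ S × b ∉ S
  descending-arc-∉ {a} {b} ab b<a = a∉S , b∉S
    where
    a∉S : a ∉ S
    a∉S a∈S = <-asym b<a (arc-ascending a∈S ab)
    b∉S : b ∉ S
    b∉S b∈S = <-asym b<a (above-rest b∈S (proj₁ (arcsIn ab)) a∉S)

  𝓡-delete : ∀ a b → 𝓡 D a b ⇔ 𝓡 (D -ᵛ S) a b
  𝓡-delete a b = mk⇔ to from
    where
    to : 𝓡 D a b → 𝓡 (D -ᵛ S) a b
    to (ab , b<a) = let (a∉S , b∉S) = descending-arc-∉ ab b<a in delete-arc⁺ ab a∉S b∉S , b<a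
    from : 𝓡 (D -ᵛ S) a b → 𝓡 D a b
    from (ab , b<a) = delete-arc⁻ ab , b<a

  𝓦-delete : ∀ a b c → 𝓦 D a b c ⇔ 𝓦 (D -ᵛ S) a b c
  𝓦-delete a b c = mk⇔ to from
    where
    to : 𝓦 D a b c → 𝓦 (D -ᵛ S) a b c
    to (a∈V , b∈V , c∈V , a<b , b<c , ca , a≉b , c≉b) =
      delete-vert⁺ a∈V a∉S , delete-vert⁺ b∈V b∉S , delete-vert⁺ c∈V c∉S , a<b , b<c
      , delete-arc⁺ ca c∉S a∉S , delete-≉⁺ a≉b , delete-≉⁺ c≉b
      where
      c∉S = proj₁ (descending-arc-∉ ca (<-trans a<b b<c))
      a∉S = proj₂ (descending-arc-∉ ca (<-trans a<b b<c))
      b∉S : b ∉ S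
      b∉S b∈S = <-asym b<c (above-rest b∈S c∈V c∉S)
    from : 𝓦 (D -ᵛ S) a b c → 𝓦 D a b c
    from (a∈V∖S , b∈V∖S , c∈V∖S , a<b , b<c , ca , a≉b , c≉b) =
      proj₁ A , proj₁ B , proj₁ C , a<b , b<c , delete-arc⁻ ca
      , delete-≉⁻ reach-closed (proj₂ A) (proj₂ B) a≉b
      , delete-≉⁻ reach-closed (proj₂ C) (proj₂ B) c≉b
      where
      A = delete-vert⁻ a∈V∖S
      B = delete-vert⁻ b∈V∖S
      C = delete-vert⁻ c∈V∖S

proposition3p4 : (n : ℕ) (D : Digraph) (S : List ℕ)
    → WellFormed D → Acyclic D → length (verts D) ≡ n → 3 ≤ n
    → Ideal D S
    → (∀ a b → 𝓡 D a b ⇔ 𝓡 (D -ᵛ S) a b)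
      × (∀ a b c → 𝓦 D a b c ⇔ 𝓦 (D -ᵛ S) a b c)
proposition3p4 _ D S wf _ _ _ ideal = 𝓡-delete wf properties , 𝓦-delete wf properties
  where
  properties : IdealProperties D S
  properties = Ideal⇒IdealProperties ideal
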